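{- Fix integers $n\ge k\ge 1$. Then $\binom{[n-1]}{k-1}\times[1,n]$ is the disjoint union $\sigma^{\mathrm{vert}}_1\sqcup\cdots\sqcup\sigma^{\mathrm{vert}}_k$, and $\binom{[n]}{k-1}\times[k,n]$ is the disjoint union $\sigma^{\mathrm{subf}}_1\sqcup\cdots\sqcup\sigma^{\mathrm{subf}}_k$.
   Context: Identify $\binom{[n]}{k}$ with $\{(i_1,\dots,i_k)\in\mathbb{P}^k:1\le i_1<\dots<i_k\le n\}$, $\mathbb{P}=\{1,2,\dots\}$. Let $\binom{[n-1]}{k-1}\times[1,n]=\{x\in\mathbb{P}^k:1\le x_1<\dots<x_{k-1}\le n-1,\ 1\le x_k\le n\}$ and $\binom{[n]}{k-1}\times[k,n]=\{x\in\mathbb{P}^k:1\le x_1<\dots<x_{k-1}\le n,\ k\le x_k\le n\}$. Set $\sigma^{\mathrm{vert}}_k=\sigma^{\mathrm{subf}}_k=\binom{[n]}{k}$, and for $j=1,\dots,k-1$: $\sigma^{\mathrm{vert}}_j=\{x\in\mathbb{P}^k: 1\le x_1<\dots<x_{j-1}<x_k\le x_j<x_{j+1}<\dots<x_{k-1}\le n-1\}$, $\sigma^{\mathrm{subf}}_j=\{x\in\mathbb{P}^k: 1\le x_1<\dots<x_{j-1}<x_k-(k-j)<x_j<x_{j+1}<\dots<x_{k-1}\le n\}$. -}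

module Defs where

open import Data.Nat using (ℕ; zero; suc; _+_; _∸_; _≤_; _<_)
open import Data.List using (List; []; _∷_; _++_; map; take; drop; [_])
open import Data.Vec using (Vec; toList)
open import Data.Product using (Σ; _×_; _,_)
open import Data.Sum using (_⊎_)
open import Data.Unit using (⊤)
open import Relation.Binary.PropositionalEquality using (_≡_)

data Rel : Set where
  LT LE : Rel

holds : Rel → ℕ → ℕ → Set
holds LT a b = a < b
holds LE a b = a ≤ b

Chain : ℕ → List (Rel × ℕ) → Set
Chain a [] = ⊤
Chain a ((r , b) ∷ rest) = holds r a b × Chain b rest

lts : List ℕ → List (Rel × ℕ)
lts = map (λ a → (LT , a))

-- Points of ℙ^k are vectors x = (x₁,…,x_k) : Vec ℕ k.
-- Chains start with "0 <", i.e. "1 ≤", which also encodes x_i ∈ ℙ.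

Binom : (n k : ℕ) → Vec ℕ k → Set
Binom n k x = Chain 0 (lts (toList x) ++ [ (LE , n) ])

ProdVert : (n k : ℕ) → Vec ℕ k → Set
ProdVert n k x = Σ (List ℕ) λ ys → Σ ℕ λ z →
  (toList x ≡ ys ++ [ z ]) × Chain 0 (lts ys ++ [ (LE , n ∸ 1) ]) × (1 ≤ z) × (z ≤ n)

ProdSubf : (n k : ℕ) → Vec ℕ k → Set
ProdSubf n k x = Σ (List ℕ) λ ys → Σ ℕ λ z →
  (toList x ≡ ys ++ [ z ]) × Chain 0 (lts ys ++ [ (LE , n) ]) × (k ≤ z) × (z ≤ n)

tailChain : Rel → ℕ → List ℕ → List (Rel × ℕ)
tailChain r bound [] = [ (LE , bound) ]
tailChain r bound (y ∷ rest) = (r , y) ∷ (lts rest ++ [ (LE , bound) ])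

-- σ^vert_j for 1 ≤ j ≤ k-1, with x = ys ++ [z], ys = (x₁,…,x_{k-1}), z = x_k :
-- 1 ≤ x₁ < … < x_{j-1} < x_k ≤ x_j < … < x_{k-1} ≤ n-1
VertLow : (n k j : ℕ) → Vec ℕ k → Set
VertLow n k j x = Σ (List ℕ) λ ys → Σ ℕ λ z →
  (toList x ≡ ys ++ [ z ]) ×
  Chain 0 (lts (take (j ∸ 1) ys) ++ (LT , z) ∷ tailChain LE (n ∸ 1) (drop (j ∸ 1) ys))

-- σ^subf_j for 1 ≤ j ≤ k-1:
-- 1 ≤ x₁ < … < x_{j-1} < x_k-(k-j) < x_j < … < x_{k-1} ≤ n
-- (truncated subtraction is harmless: the chain forces x_k-(k-j) ≥ 1)
SubfLow : (n k j : ℕ) → Vec ℕ k → Set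
SubfLow n k j x = Σ (List ℕ) λ ys → Σ ℕ λ z →
  (toList x ≡ ys ++ [ z ]) ×
  Chain 0 (lts (take (j ∸ 1) ys) ++ (LT , z ∸ (k ∸ j)) ∷ tailChain LT n (drop (j ∸ 1) ys))

σvert : (n k j : ℕ) → Vec ℕ k → Set
σvert n k j x = ((1 ≤ j) × (j < k) × VertLow n k j x) ⊎ ((j ≡ k) × Binom n k x)

σsubf : (n k j : ℕ) → Vec ℕ k → Set
σsubf n k j x = ((1 ≤ j) × (j < k) × SubfLow n k j x) ⊎ ((j ≡ k) × Binom n k x)

IsDisjointUnion : (k : ℕ) → (A : Vec ℕ k → Set) → (S : ℕ → Vec ℕ k → Set) → Set
IsDisjointUnion k A S =
  ((x : Vec ℕ k) → A x → Σ ℕ λ j → (1 ≤ j) × (j ≤ k) × S j x) ×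
  ((x : Vec ℕ k) (j : ℕ) → 1 ≤ j → j ≤ k → S j x → A x) ×
  ((x : Vec ℕ k) (j j′ : ℕ) → S j x → S j′ x → j ≡ j′)

-- Write x = (y₁,…,y_{k-1}, z) with y₁ < ⋯ < y_{k-1}.  Each σ_j with j < k places the last
-- coordinate z between y_{j-1} and y_j (for σ^subf after the shift z ↦ z-(k-j)), and σ_k places
-- it above every y_i.  Since the y_i increase strictly, the test "z fits before y_j" is monotone
-- in j, so j is forced to be the first index at which it succeeds (k if none does): the σ_j
-- are the fibres of this position function on the product set.

module Submission where

open import Defs
open import Data.Nat using (ℕ; zero; suc; _+_; _∸_; _≤_; _<_; z≤n; s≤s)
open import Data.Nat.Properties
open import Data.List using (List; []; _∷_; _++_; _∷ʳ_; take; drop; [_]; length)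
open import Data.List.Properties using (∷ʳ-injective)
open import Data.Vec using (Vec; toList; init; last; initLast)
open import Data.Vec.Properties using (toList-∷ʳ; length-toList)
open import Data.Product using (Σ; _×_; _,_; proj₁; proj₂)
open import Data.Sum using (_⊎_; inj₁; inj₂)
open import Data.Bool using (if_then_else_)
open import Relation.Nullary using (¬_; Dec; yes; no; does; contradiction)
open import Relation.Binary.PropositionalEquality using (_≡_; refl; sym; trans; cong; subst)

m<o∸n⇒m+n<o : ∀ m n o → m < o ∸ n → m + n < o
m<o∸n⇒m+n<o m zero    o       m<o   = subst (_< o) (sym (+-identityʳ m)) m<o
m<o∸n⇒m+n<o m (suc n) zero    ()
m<o∸n⇒m+n<o m (suc n) (suc o) m<o∸n =
  subst (_< suc o) (sym (+-suc m n)) (s≤s (m<o∸n⇒m+n<o m n o m<o∸n))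

m+n<o⇒m≤o∸1+n : ∀ m n o → m + n < o → m ≤ o ∸ suc n
m+n<o⇒m≤o∸1+n m n o m+n<o = m+n≤o⇒m≤o∸n m (subst (_≤ o) (sym (+-suc m n)) m+n<o)

m≤o∸1+n⇒m+n<o : ∀ m n o → n < o → m ≤ o ∸ suc n → m + n < o
m≤o∸1+n⇒m+n<o m n o n<o m≤o∸1+n =
  subst (_≤ o) (+-suc m n) (m≤o∸n⇒m+n≤o m n<o m≤o∸1+n)

module _ {P : ℕ → List ℕ → Set} (P? : ∀ y ys → Dec (P y ys)) where

  firstFit : List ℕ → ℕ
  firstFit []       = 0
  firstFit (y ∷ ys) = if does (P? y ys) then 0 else suc (firstFit ys)

  firstFit-here : ∀ y ys → P y ys → firstFit (y ∷ ys) ≡ 0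
  firstFit-here y ys p with P? y ys
  ... | yes _ = refl
  ... | no ¬p = contradiction p ¬p

  firstFit-there : ∀ y ys → ¬ P y ys → firstFit (y ∷ ys) ≡ suc (firstFit ys)
  firstFit-there y ys ¬p with P? y ys
  ... | yes p = contradiction p ¬p
  ... | no _  = refl

fibres-isDisjointUnion : ∀ {k} {A : Vec ℕ k → Set} {S : ℕ → Vec ℕ k → Set}
  (pos : Vec ℕ k → ℕ) →
  (∀ x → A x → 1 ≤ pos x × pos x ≤ k × S (pos x) x) →
  (∀ j x → S j x → A x × pos x ≡ j) →
  IsDisjointUnion k A S
fibres-isDisjointUnion pos cover fibre =
  (λ x a → pos x , cover x a) ,
  (λ x j _ _ s → proj₁ (fibre j x s)) ,
  (λ x j j′ s s′ → trans (sym (proj₂ (fibre j x s))) (proj₂ (fibre j′ x s′)))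

toList-initLast : ∀ {m} (x : Vec ℕ (suc m)) → toList x ≡ toList (init x) ∷ʳ last x
toList-initLast x = trans (cong toList (proj₂ (proj₂ (initLast x)))) (toList-∷ʳ (last x) (init x))

toList≡∷ʳ⇒initLast : ∀ {m} (x : Vec ℕ (suc m)) {ys z} → toList x ≡ ys ∷ʳ z →
  ys ≡ toList (init x) × z ≡ last x
toList≡∷ʳ⇒initLast x {ys} eq = ∷ʳ-injective ys _ (trans (sym eq) (toList-initLast x))

Increasing : ℕ → List ℕ → ℕ → Set
Increasing a ys b = Chain a (lts ys ++ [ (LE , b) ])

Increasing⇒+length≤ : ∀ a ys b → Increasing a ys b → a + length ys ≤ b
Increasing⇒+length≤ a []       b (a≤b , _) = subst (_≤ b) (sym (+-identityʳ a)) a≤b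
Increasing⇒+length≤ a (y ∷ ys) b (a<y , inc) =
  subst (_≤ b) (sym (+-suc a (length ys)))
    (≤-trans (+-monoˡ-≤ (length ys) a<y) (Increasing⇒+length≤ y ys b inc))

Increasing⇒≤ : ∀ a ys b → Increasing a ys b → a ≤ b
Increasing⇒≤ a ys b inc = m+n≤o⇒m≤o a (Increasing⇒+length≤ a ys b inc)

Inserted : Rel → ℕ → ℕ → List ℕ → ℕ → ℕ → Set
Inserted r a b ys v i = Chain a (lts (take i ys) ++ (LT , v) ∷ tailChain r b (drop i ys))

-- Insertion positions are 0-based: i corresponds to σ_{i+1}, and i = length ys to σ_k.
Insertion : ℕ → ℕ → List ℕ → ℕ → (ℕ → Set) → ℕ → Set
Insertion a b ys z Low i = (i < length ys × Low i) ⊎ (i ≡ length ys × Increasing a (ys ∷ʳ z) b)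

Snoc : ∀ {k} → (List ℕ → ℕ → Set) → Vec ℕ k → Set
Snoc P x = Σ (List ℕ) λ ys → Σ ℕ λ z → (toList x ≡ ys ∷ʳ z) × P ys z

SnocFamily : ∀ k → ℕ → (List ℕ → ℕ → ℕ → Set) → ℕ → Vec ℕ k → Set
SnocFamily k b Low j x =
  ((1 ≤ j) × (j < k) × Snoc (λ ys z → Low ys z j) x) ⊎ ((j ≡ k) × Increasing 0 (toList x) b)

-- Base and Low take k-1 as first argument (σ^subf refers to k); on a decomposition
-- x = ys ∷ʳ z it is length ys, which is how sound and complete see it.
module _ (b : ℕ) (Base : ℕ → List ℕ → ℕ → Set)
  (Low : ℕ → List ℕ → ℕ → ℕ → Set) (position : List ℕ → ℕ → ℕ)
  (sound : ∀ ys z i → Insertion 0 b ys z (λ i → Low (length ys) ys z (suc i)) i →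
           Base (length ys) ys z × position ys z ≡ i)
  (complete : ∀ ys z → Base (length ys) ys z →
              Insertion 0 b ys z (λ i → Low (length ys) ys z (suc i)) (position ys z))
  where

  snoc-isDisjointUnion : ∀ m →
    IsDisjointUnion (suc m) (Snoc (Base m)) (SnocFamily (suc m) b (Low m))
  snoc-isDisjointUnion m = fibres-isDisjointUnion pos cover fibre
    where
    pos : Vec ℕ (suc m) → ℕ
    pos x = suc (position (toList (init x)) (last x))

    len : (x : Vec ℕ (suc m)) → length (toList (init x)) ≡ m
    len x = length-toList (init x)

    cover : ∀ x → Snoc (Base m) x →
      1 ≤ pos x × pos x ≤ suc m × SnocFamily (suc m) b (Low m) (pos x) x
    cover x (ys , z , eq , base) with refl , refl ← toList≡∷ʳ⇒initLast x eq
      with complete ys z (subst (λ m → Base m ys z) (sym (len x)) base)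
    ... | inj₁ (p<ℓ , low) =
      s≤s z≤n , s≤s (<⇒≤ p<m) , inj₁ (s≤s z≤n , s≤s p<m , ys , z , eq , low′)
      where
      p<m = subst (position ys z <_) (len x) p<ℓ
      low′ = subst (λ m → Low m ys z (suc (position ys z))) (len x) low
    ... | inj₂ (p≡ℓ , inc) =
      s≤s z≤n , s≤s (≤-reflexive p≡m) ,
      inj₂ (cong suc p≡m , subst (λ l → Increasing 0 l b) (sym eq) inc)
      where p≡m = trans p≡ℓ (len x)

    fibre : ∀ j x → SnocFamily (suc m) b (Low m) j x → Snoc (Base m) x × pos x ≡ j
    fibre zero x (inj₁ (() , _))
    fibre (suc i) x (inj₁ (_ , s≤s i<m , ys , z , eq , low))
      with refl , refl ← toList≡∷ʳ⇒initLast x eq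
      with base , p≡i ← sound ys z i (inj₁ ( subst (i <_) (sym (len x)) i<m
                                            , subst (λ m → Low m ys z (suc i)) (sym (len x)) low))
      = (ys , z , eq , subst (λ m → Base m ys z) (len x) base) , cong suc p≡i
    fibre j x (inj₂ (refl , inc)) =
      (ys , z , toList-initLast x , subst (λ m → Base m ys z) (len x) (proj₁ top)) ,
      cong suc (trans (proj₂ top) (len x))
      where
      ys = toList (init x)
      z  = last x
      top = sound ys z (length ys)
              (inj₂ (refl , subst (λ l → Increasing 0 l b) (toList-initLast x) inc))

vertFits? : ∀ z y (ys : List ℕ) → Dec (z ≤ y)
vertFits? z y _ = z ≤? y

vertPosition : List ℕ → ℕ → ℕ
vertPosition ys z = firstFit (vertFits? z) ys

VertBase : ℕ → ℕ → List ℕ → ℕ → Set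
VertBase a b ys z = Increasing a ys b × a < z × z ≤ suc b

vertBase-∷ : ∀ {a b y ys z i} → a < y → VertBase y b ys z × vertPosition ys z ≡ i →
  VertBase a b (y ∷ ys) z × vertPosition (y ∷ ys) z ≡ suc i
vertBase-∷ {y = y} {ys} {z} a<y ((inc , y<z , z≤1+b) , p≡i) =
  ((a<y , inc) , <-trans a<y y<z , z≤1+b) ,
  trans (firstFit-there (vertFits? z) y ys (<⇒≱ y<z)) (cong suc p≡i)

vertInsertion⇒ : ∀ a b ys z i → Insertion a (suc b) ys z (Inserted LE a b ys z) i →
  VertBase a b ys z × vertPosition ys z ≡ i
vertInsertion⇒ a b [] z i (inj₁ (() , _))
vertInsertion⇒ a b [] z i (inj₂ (refl , a<z , z≤1+b , _)) =
  ((≤-pred (<-≤-trans a<z z≤1+b) , _) , a<z , z≤1+b) , refl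
vertInsertion⇒ a b (y ∷ ys) z zero (inj₁ (_ , a<z , z≤y , inc)) =
  ((<-≤-trans a<z z≤y , inc) , a<z , m≤n⇒m≤1+n (≤-trans z≤y (Increasing⇒≤ y ys b inc))) ,
  firstFit-here (vertFits? z) y ys z≤y
vertInsertion⇒ a b (y ∷ ys) z zero (inj₂ (() , _))
vertInsertion⇒ a b (y ∷ ys) z (suc i) (inj₁ (s≤s i<m , a<y , ins)) =
  vertBase-∷ a<y (vertInsertion⇒ y b ys z i (inj₁ (i<m , ins)))
vertInsertion⇒ a b (y ∷ ys) z (suc i) (inj₂ (e , a<y , inc)) =
  vertBase-∷ a<y (vertInsertion⇒ y b ys z i (inj₂ (suc-injective e , inc)))

⇒vertInsertion : ∀ a b ys z → VertBase a b ys z →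
  Insertion a (suc b) ys z (Inserted LE a b ys z) (vertPosition ys z)
⇒vertInsertion a b [] z (_ , a<z , z≤1+b) = inj₂ (refl , a<z , z≤1+b , _)
⇒vertInsertion a b (y ∷ ys) z ((a<y , inc) , a<z , z≤1+b) with vertFits? z y ys
... | yes z≤y rewrite firstFit-here (vertFits? z) y ys z≤y = inj₁ (s≤s z≤n , a<z , z≤y , inc)
... | no z≰y rewrite firstFit-there (vertFits? z) y ys z≰y
  with ⇒vertInsertion y b ys z (inc , ≰⇒> z≰y , z≤1+b)
...   | inj₁ (p<m , ins) = inj₁ (s≤s p<m , a<y , ins)
...   | inj₂ (p≡m , inc′) = inj₂ (cong suc p≡m , a<y , inc′)

-- With y ∷ ys = (x_j,…,x_{k-1}), i.e. k-j entries, this tests x_k-(k-j) < x_j.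
subfFits? : ∀ z y (ys : List ℕ) → Dec (z ∸ suc (length ys) < y)
subfFits? z y ys = z ∸ suc (length ys) <? y

subfPosition : List ℕ → ℕ → ℕ
subfPosition ys z = firstFit (subfFits? z) ys

SubfBase : ℕ → ℕ → List ℕ → ℕ → Set
SubfBase a b ys z = Increasing a ys b × a + length ys < z × z ≤ b

SubfInserted : ℕ → ℕ → List ℕ → ℕ → ℕ → Set
SubfInserted a b ys z i = Inserted LT a b ys (z ∸ (length ys ∸ i)) i

subfBase-∷ : ∀ {a b y ys z i} → a < y → SubfBase y b ys z × subfPosition ys z ≡ i →
  SubfBase a b (y ∷ ys) z × subfPosition (y ∷ ys) z ≡ suc i
subfBase-∷ {a} {y = y} {ys} {z} a<y ((inc , y+m<z , z≤b) , p≡i) =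
  ((a<y , inc) , ≤-<-trans a+1+m≤y+m y+m<z , z≤b) ,
  trans (firstFit-there (subfFits? z) y ys (≤⇒≯ (m+n<o⇒m≤o∸1+n y m z y+m<z)))
        (cong suc p≡i)
  where
  m = length ys
  a+1+m≤y+m : a + suc m ≤ y + m
  a+1+m≤y+m = subst (_≤ y + m) (sym (+-suc a m)) (+-monoˡ-≤ m a<y)

subfInsertion⇒ : ∀ a b ys z i → Insertion a b ys z (SubfInserted a b ys z) i →
  SubfBase a b ys z × subfPosition ys z ≡ i
subfInsertion⇒ a b [] z i (inj₁ (() , _))
subfInsertion⇒ a b [] z i (inj₂ (refl , a<z , z≤b , _)) =
  ((<⇒≤ (<-≤-trans a<z z≤b) , _) , subst (_< z) (sym (+-identityʳ a)) a<z , z≤b) , refl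
subfInsertion⇒ a b (y ∷ ys) z zero (inj₁ (_ , a<v , v<y , inc)) =
  ( (<-trans a<v v<y , inc)
  , m<o∸n⇒m+n<o a (suc m) z a<v
  , ≤-trans z≤y+m (Increasing⇒+length≤ y ys b inc)) ,
  firstFit-here (subfFits? z) y ys v<y
  where
  m = length ys
  z≤y+m : z ≤ y + m
  z≤y+m = ≮⇒≥ (λ y+m<z → ≤⇒≯ (m+n<o⇒m≤o∸1+n y m z y+m<z) v<y)
subfInsertion⇒ a b (y ∷ ys) z zero (inj₂ (() , _))
subfInsertion⇒ a b (y ∷ ys) z (suc i) (inj₁ (s≤s i<m , a<y , ins)) =
  subfBase-∷ a<y (subfInsertion⇒ y b ys z i (inj₁ (i<m , ins)))
subfInsertion⇒ a b (y ∷ ys) z (suc i) (inj₂ (e , a<y , inc)) =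
  subfBase-∷ a<y (subfInsertion⇒ y b ys z i (inj₂ (suc-injective e , inc)))

⇒subfInsertion : ∀ a b ys z → SubfBase a b ys z →
  Insertion a b ys z (SubfInserted a b ys z) (subfPosition ys z)
⇒subfInsertion a b [] z (_ , a+0<z , z≤b) =
  inj₂ (refl , subst (_< z) (+-identityʳ a) a+0<z , z≤b , _)
⇒subfInsertion a b (y ∷ ys) z ((a<y , inc) , a+1+m<z , z≤b) with subfFits? z y ys
... | yes v<y rewrite firstFit-here (subfFits? z) y ys v<y =
  inj₁ (s≤s z≤n , m+n≤o⇒m≤o∸n (suc a) a+1+m<z , v<y , inc)
... | no v≮y rewrite firstFit-there (subfFits? z) y ys v≮y
  with ⇒subfInsertion y b ys z
         (inc , m≤o∸1+n⇒m+n<o y (length ys) z 1+m≤z (≮⇒≥ v≮y) , z≤b)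
  where
  1+m≤z : suc (length ys) ≤ z
  1+m≤z = ≤-trans (m≤n+m (suc (length ys)) a) (<⇒≤ a+1+m<z)
...   | inj₁ (p<m , ins) = inj₁ (s≤s p<m , a<y , ins)
...   | inj₂ (p≡m , inc′) = inj₂ (cong suc p≡m , a<y , inc′)

vertPartition : ∀ b m → IsDisjointUnion (suc m) (ProdVert (suc b) (suc m)) (σvert (suc b) (suc m))
vertPartition b = snoc-isDisjointUnion (suc b) (λ _ → VertBase 0 b)
  (λ _ ys z j → Inserted LE 0 b ys z (j ∸ 1))
  vertPosition (vertInsertion⇒ 0 b) (⇒vertInsertion 0 b)

subfPartition : ∀ b m → IsDisjointUnion (suc m) (ProdSubf b (suc m)) (σsubf b (suc m))
subfPartition b = snoc-isDisjointUnion b (λ m ys z → Increasing 0 ys b × suc m ≤ z × z ≤ b)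
  (λ m ys z j → Inserted LT 0 b ys (z ∸ (suc m ∸ j)) (j ∸ 1))
  subfPosition (subfInsertion⇒ 0 b) (⇒subfInsertion 0 b)

proposition4p14 : (n k : ℕ) → 1 ≤ k → k ≤ n →
    IsDisjointUnion k (ProdVert n k) (σvert n k) × IsDisjointUnion k (ProdSubf n k) (σsubf n k)
proposition4p14 (suc b) (suc m) _ (s≤s _) = vertPartition b m , subfPartition (suc b) m
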